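{- Let $q$ be a prime power, $r^*=q^3-q$, $u^*=q^3+q^2$, and let $\Omega_{r,s_1,\dots,s_{q-1},t_1,\dots,t_{q-1},u}$ be as in the context. If $r\ge r^*$, $u\ge u^*$ and $0\le s_\mu,t_\nu<q^2+q$ for $1\le\mu,\nu\le q-1$, then \[\#\Omega_{r,s_1,\dots,s_{q-1},t_1,\dots,t_{q-1},u}=\#\Omega_{r^*,s_1,\dots,s_{q-1},t_1,\dots,t_{q-1},u^*}+(r-r^*)+(u-u^*).\]
   Context: $q$ is a power of a prime. For integers $r,s_1,\dots,s_{q-1},t_1,\dots,t_{q-1},u$, $\Omega_{r,s_1,\dots,s_{q-1},t_1,\dots,t_{q-1},u}$ is the set of $(i,j_1,\dots,j_{q-1},k_1,\dots,k_{q-1})\in\mathbb{Z}^{2q-1}$ with $-r\le i$; $-s_\mu\le i+(q^2+q)k_\mu<-s_\mu+(q^2+q)$ for $1\le\mu\le q-1$; $-t_\nu\le qi+(q^2+q)j_\nu-(q+1)\sum_{\mu=1}^{q-1}k_\mu<-t_\nu+(q^2+q)$ for $1\le\nu\le q-1$; $-u\le -q^2i-(q^2+q)\sum_{\nu}j_\nu-(q+1)\sum_\mu k_\mu$. -}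

module Defs where

open import Data.Nat as ℕ using (ℕ; _∸_)
open import Data.Nat.Primality using (Prime)
open import Data.Integer as ℤ using (ℤ; +_; _+_; _*_; -_; _-_; _≤_; _<_)
open import Data.Fin using (Fin)
open import Data.Vec using (Vec; lookup; foldr)
open import Data.List using (List; length)
open import Data.List.Membership.Propositional using (_∈_)
open import Data.List.Relation.Unary.Unique.Propositional using (Unique)
open import Data.Product using (Σ; ∃; _×_)
open import Function.Bundles using (_⇔_)
open import Relation.Binary.PropositionalEquality using (_≡_)

IsPrimePower : ℕ → Set
IsPrimePower q = ∃ λ p → ∃ λ k → Prime p × (1 ℕ.≤ k) × (q ≡ p ℕ.^ k)

sumℤ : ∀ {n} → Vec ℤ n → ℤ
sumℤ = foldr _ _+_ (+ 0)

Point : ℕ → Set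
Point q = ℤ × Vec ℤ (q ∸ 1) × Vec ℤ (q ∸ 1)

-- membership in Ω_{r,s,t,u}; indices μ, ν range over Fin (q-1), i.e. 1..q-1
InΩ : (q : ℕ) → ℤ → Vec ℤ (q ∸ 1) → Vec ℤ (q ∸ 1) → ℤ → Point q → Set
InΩ q r s t u (i Data.Product., j Data.Product., k) =
  (- r ≤ i)
  × (∀ (μ : Fin (q ∸ 1)) →
       (- lookup s μ ≤ i + m * lookup k μ) × (i + m * lookup k μ < - lookup s μ + m))
  × (∀ (ν : Fin (q ∸ 1)) →
       (- lookup t ν ≤ Q * i + m * lookup j ν - (Q + + 1) * sumℤ k)
       × (Q * i + m * lookup j ν - (Q + + 1) * sumℤ k < - lookup t ν + m))
  × (- u ≤ - (Q * Q * i) - m * sumℤ j - (Q + + 1) * sumℤ k)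
  where
  Q : ℤ
  Q = + q
  m : ℤ
  m = Q * Q + Q

HasCard : {A : Set} → (A → Set) → ℕ → Set
HasCard {A} P N = Σ (List A) λ l → Unique l × (∀ x → (x ∈ l) ⇔ P x) × (length l ≡ N)

module Submission where

-- Write a = i and d = -q²i - (q²+q)Σj - (q+1)Σk for the two forms of Ω bounded
-- only from one side; the other 2(q-1) forms b_μ, c_ν are confined to windows
-- of length m = q² + q.  Given i, the windows for the b_μ fix each k_μ, and then
-- those for the c_ν fix each j_ν, so a is a coordinate on the windowed points:
-- a bijection onto ℤ.  A linear symmetry τ of the windowed points exchanges a
-- and d, so d is a coordinate too.  Moreover a + d = -(Σ b_μ + Σ c_ν), hence
-- |a + d| ≤ 2(q-1)m = 2r*.  The abstract counting principle `TwoCoordinates`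
-- then shows that beyond (r*, u*) each unit increase of r or u adds exactly
-- one point.

open import Defs
open import Data.Nat as ℕ using (ℕ; _∸_)
import Data.Nat.Properties as ℕP
open import Data.Integer as ℤ using (ℤ; +_; _+_; _*_; -_; _-_; _≤_; _<_; ∣_∣; 0ℤ; 1ℤ; +≤+; +<+)
import Data.Integer.Properties as ℤP
open import Data.Integer.Tactic.RingSolver using (solve-∀)
import Data.Nat.Tactic.RingSolver as ℕ-Solver
open import Algebra.Properties.AbelianGroup ℤP.+-0-abelianGroup using (xyx⁻¹≈y)
open import Data.Integer.DivMod using (_/ℕ_; _%ℕ_; a≡a%ℕn+[a/ℕn]*n; n%ℕd<d)
open import Data.List using (map; filter; _++_; upTo; length)
open import Data.List.Properties using (length-map; length-++; length-upTo)
open import Data.List.Membership.Propositional using (_∈_)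
open import Data.List.Membership.Propositional.Properties
  using (∈-map⁺; ∈-map⁻; ∈-++⁺ˡ; ∈-++⁺ʳ; ∈-++⁻; ∈-filter⁺; ∈-filter⁻; ∈-upTo⁺; ∈-upTo⁻)
import Data.List.Relation.Unary.Unique.Propositional.Properties as Unique
open import Data.Product using (∃; _×_; _,_; proj₁; proj₂)
open import Data.Sum as Sum using (_⊎_; inj₁; inj₂)
open import Data.Fin using (Fin; zero; suc)
open import Data.Vec using (Vec; []; _∷_; lookup; tabulate)
import Data.Vec.Properties as Vecₚ
open import Data.Nat.Primality using (prime⇒nonZero)
open import Data.Empty using (⊥; ⊥-elim)
open import Function using (_∘_)
open import Function.Bundles using (_⇔_; mk⇔; Equivalence)
open import Function.Properties.Equivalence using () renaming (trans to ⇔-trans)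
open import Relation.Binary.PropositionalEquality
open import Relation.Nullary using (yes; no)
open import Relation.Unary using (Decidable)

open Equivalence using (to; from)

module _ {A : Set} where

  HasCard-cong : {P R : A → Set} {n : ℕ} → (∀ x → P x ⇔ R x) → HasCard P n → HasCard R n
  HasCard-cong P⇔R (l , unique , mem , len) = l , unique , (λ x → ⇔-trans (mem x) (P⇔R x)) , len

  HasCard-⊎ : {P R : A → Set} {m n : ℕ} → (∀ x → P x → R x → ⊥) →
    HasCard P m → HasCard R n → HasCard (λ x → P x ⊎ R x) (m ℕ.+ n)
  HasCard-⊎ disjoint (l₁ , unique₁ , mem₁ , len₁) (l₂ , unique₂ , mem₂ , len₂) =
    l₁ ++ l₂ ,
    Unique.++⁺ unique₁ unique₂ (λ (x∈l₁ , x∈l₂) → disjoint _ (to (mem₁ _) x∈l₁) (to (mem₂ _) x∈l₂)) ,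
    (λ x → mk⇔ (Sum.map (to (mem₁ x)) (to (mem₂ x)) ∘ ∈-++⁻ l₁)
               Sum.[ ∈-++⁺ˡ ∘ from (mem₁ x) , ∈-++⁺ʳ l₁ ∘ from (mem₂ x) ]) ,
    trans (length-++ l₁) (cong₂ ℕ._+_ len₁ len₂)

  HasCard-filter : {P R : A → Set} {n : ℕ} → Decidable R → HasCard P n →
    ∃ λ m → HasCard (λ x → P x × R x) m
  HasCard-filter R? (l , unique , mem , _) =
    length (filter R? l) , filter R? l , Unique.filter⁺ R? unique ,
    (λ x → mk⇔ (λ x∈ → let (x∈l , r) = ∈-filter⁻ R? x∈ in to (mem x) x∈l , r)
               (λ (p , r) → ∈-filter⁺ R? (from (mem x) p) r)) ,
    refl

-- Linear inequalities over ℤ are certified by writing the gap as a sum of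
-- non-negative terms; these lemmas convert between the two forms.
gap-≤ : ∀ {x y} → x ≤ y → 0ℤ ≤ y - x
gap-≤ = ℤP.i≤j⇒0≤j-i

gap-< : ∀ {x y} → x < y → 0ℤ ≤ y - (1ℤ + x)
gap-< = ℤP.i≤j⇒0≤j-i ∘ ℤP.i<j⇒suc[i]≤j

≤-by-gap : ∀ {x y e} → 0ℤ ≤ e → e ≡ y - x → x ≤ y
≤-by-gap 0≤e e≡ = ℤP.0≤i-j⇒j≤i (subst (0ℤ ≤_) e≡ 0≤e)

<-by-gap : ∀ {x y e} → 0ℤ ≤ e → e ≡ y - (1ℤ + x) → x < y
<-by-gap 0≤e e≡ = ℤP.suc[i]≤j⇒i<j (≤-by-gap 0≤e e≡)

+∣y-x∣≡y-x : ∀ {x y} → x ≤ y → + ∣ y - x ∣ ≡ y - x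
+∣y-x∣≡y-x = ℤP.0≤i⇒+∣i∣≡i ∘ gap-≤

complementary : ∀ {K R U} {x y} → K ℕ.≤ R ℕ.+ U ℕ.+ 1 →
  - + K ≤ x + y → x < - + R → - + U ≤ y
complementary {K} {R} {U} {x} {y} K≤ lower x<-R =
  ≤-by-gap (ℤP.+-mono-≤ (ℤP.+-mono-≤ (gap-≤ lower) (gap-< x<-R)) (gap-≤ (+≤+ K≤)))
           (identity x y (+ K) (+ R) (+ U))
  where
  identity : ∀ x y K R U →
    ((x + y) - (- K)) + ((- R) - (1ℤ + x)) + ((R + U + 1ℤ) - K) ≡ y - (- U)
  identity = solve-∀

bounded-above : ∀ {K U} {x y} → - + U ≤ y → x + y ≤ + K → x < + K + + U + 1ℤ
bounded-above {K} {U} {x} {y} -U≤y upper =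
  <-by-gap (ℤP.+-mono-≤ (gap-≤ upper) (gap-≤ -U≤y)) (identity x y (+ K) (+ U))
  where
  identity : ∀ x y K U → (K - (x + y)) + (y - (- U)) ≡ (K + U + 1ℤ) - (1ℤ + x)
  identity = solve-∀

HasCard-interval : ∀ lo l {hi} → lo + + l ≡ hi → HasCard (λ y → lo ≤ y × y < hi) l
HasCard-interval lo l refl =
  map offset (upTo l) ,
  Unique.map⁺ offset-injective (Unique.upTo⁺ l) ,
  (λ y → mk⇔ in-interval in-list) ,
  trans (length-map offset (upTo l)) (length-upTo l)
  where
  offset : ℕ → ℤ
  offset k = lo + + k

  offset-injective : ∀ {k k'} → offset k ≡ offset k' → k ≡ k'
  offset-injective {k} {k'} e =
    ℤP.+-injective (trans (sym (xyx⁻¹≈y lo (+ k))) (trans (cong (_- lo) e) (xyx⁻¹≈y lo (+ k'))))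

  in-interval : ∀ {y} → y ∈ map offset (upTo l) → lo ≤ y × y < lo + + l
  in-interval y∈ with ∈-map⁻ offset y∈
  ... | k , k∈ , refl = ℤP.i≤i+j lo (+ k) , ℤP.+-monoʳ-< lo (+<+ (∈-upTo⁻ k∈))

  in-list : ∀ {y} → lo ≤ y × y < lo + + l → y ∈ map offset (upTo l)
  in-list {y} (lo≤y , y<hi) = subst (_∈ map offset (upTo l)) lo+k≡y (∈-map⁺ offset (∈-upTo⁺ k<l))
    where
    k : ℕ
    k = ∣ y - lo ∣
    +k≡y-lo : + k ≡ y - lo
    +k≡y-lo = +∣y-x∣≡y-x lo≤y
    lo+k≡y : lo + + k ≡ y
    lo+k≡y = trans (cong (λ z → lo + z) +k≡y-lo) (lo+[y-lo]≡y lo y)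
      where lo+[y-lo]≡y : ∀ lo y → lo + (y - lo) ≡ y
            lo+[y-lo]≡y = solve-∀
    k<l : k ℕ.< l
    k<l = ℤP.drop‿+<+ (subst₂ _<_ (sym +k≡y-lo) (xyx⁻¹≈y lo (+ l)) (ℤP.+-monoˡ-< (- lo) y<hi))

record Coordinate {P : Set} (W : P → Set) (f : P → ℤ) : Set where
  field
    point   : ℤ → P
    point-W : ∀ x → W (point x)
    f-point : ∀ x → f (point x) ≡ x
    point-f : ∀ p → W p → point (f p) ≡ p

  injective : ∀ {p p'} → W p → W p' → f p ≡ f p' → p ≡ p'
  injective {p} {p'} w w' e = trans (sym (point-f p w)) (trans (cong point e) (point-f p' w'))

  count : {S : ℤ → Set} {n : ℕ} → HasCard S n → HasCard (λ p → W p × S (f p)) n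
  count {S} (l , unique , mem , len) =
    map point l ,
    Unique.map⁺ (λ {x} {y} e → trans (sym (f-point x)) (trans (cong f e) (f-point y))) unique ,
    (λ p → mk⇔ in-W in-list) ,
    trans (length-map point l) len
    where
    in-W : ∀ {p} → p ∈ map point l → W p × S (f p)
    in-W p∈ with ∈-map⁻ point p∈
    ... | x , x∈l , refl = point-W x , subst S (sym (f-point x)) (to (mem x) x∈l)

    in-list : ∀ {p} → W p × S (f p) → p ∈ map point l
    in-list {p} (w , s) = subst (_∈ map point l) (point-f p w) (∈-map⁺ point (from (mem (f p)) s))

-- A map τ that exchanges W and W' and turns f' into f (and f into f') carries
-- a coordinate f on W to the coordinate f' on W', provided f is also a
-- coordinate on W' (which forces τ to be an involution on W').
swap-coordinate : {P : Set} {W W' : P → Set} {f f' : P → ℤ} (τ : P → P) →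
  Coordinate W f → Coordinate W' f →
  (∀ p → W p → W' (τ p)) → (∀ p → W' p → W (τ p)) →
  (∀ p → f' (τ p) ≡ f p) → (∀ p → f (τ p) ≡ f' p) → Coordinate W' f'
swap-coordinate {W' = W'} {f} {f'} τ C C' τ-W τ-W' f'∘τ f∘τ = record
  { point   = τ ∘ C.point
  ; point-W = λ x → τ-W (C.point x) (C.point-W x)
  ; f-point = λ x → trans (f'∘τ (C.point x)) (C.f-point x)
  ; point-f = λ p w' → trans (cong τ (point-of-f' p w')) (ττ p w')
  }
  where
  module C = Coordinate C
  module C' = Coordinate C'

  point-of-f' : ∀ p → W' p → C.point (f' p) ≡ τ p
  point-of-f' p w' = trans (cong C.point (sym (f∘τ p))) (C.point-f (τ p) (τ-W' p w'))

  ττ : ∀ p → W' p → τ (τ p) ≡ p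
  ττ p w' = C'.injective (τ-W (τ p) (τ-W' p w')) w' (trans (f∘τ (τ p)) (f'∘τ p))

-- Then the region {W, a ≥ -R, d ≥ -U} is finite (there a ≤ K + U).
-- When K ≤ R + U + 1, enlarging R to r and U to u only adds the points with
-- a ∈ [-r, -R) (where automatically d ≥ -U) and those with d ∈ [-u, -U)
-- (where a ≥ -R); these two tails are disjoint and contribute one point per
-- value of a, resp. d.
module TwoCoordinates {P : Set} {W : P → Set} {a d : P → ℤ}
    (A : Coordinate W a) (D : Coordinate W d) (K : ℕ)
    (a+d-bounded : ∀ p → W p → (- + K ≤ a p + d p) × (a p + d p ≤ + K)) where

  Region : ℤ → ℤ → P → Set
  Region r u p = (- r ≤ a p) × W p × (- u ≤ d p)

  Tail : (P → ℤ) → ℤ → ℕ → P → Set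
  Tail f r R p = W p × (- r ≤ f p × f p < - + R)

  HasCard-tail : ∀ {f} → Coordinate W f → ∀ {r} R → + R ≤ r → HasCard (Tail f r R) ∣ r - + R ∣
  HasCard-tail F {r} R R≤r = Coordinate.count F (HasCard-interval (- r) ∣ r - + R ∣ top)
    where
    top : - r + + ∣ r - + R ∣ ≡ - + R
    top = trans (cong (λ z → - r + z) (+∣y-x∣≡y-x R≤r)) (identity r (+ R))
      where identity : ∀ r R → - r + (r - R) ≡ - R
            identity = solve-∀

  module _ (R U : ℕ) (K≤R+U+1 : K ℕ.≤ R ℕ.+ U ℕ.+ 1) where

    d-above : ∀ p → W p → a p < - + R → - + U ≤ d p
    d-above p w = complementary K≤R+U+1 (proj₁ (a+d-bounded p w))

    a-above : ∀ p → W p → d p < - + U → - + R ≤ a p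
    a-above p w = complementary (subst (K ℕ.≤_) (cong (ℕ._+ 1) (ℕP.+-comm R U)) K≤R+U+1)
                    (subst (- + K ≤_) (ℤP.+-comm (a p) (d p)) (proj₁ (a+d-bounded p w)))

    -- on the core region a ranges over [-R, K + U], so the core is a
    -- decidable part of the points with a in that interval
    HasCard-core : ∃ λ N → HasCard (Region (+ R) (+ U)) N
    HasCard-core =
      let (N , card) = HasCard-filter (λ p → - + U ℤ.≤? d p) (Coordinate.count A a-range) in
      N , HasCard-cong (λ p → mk⇔ forget (restore p)) card
      where
      a-range : HasCard (λ x → - + R ≤ x × x < + K + + U + 1ℤ) (R ℕ.+ (K ℕ.+ U ℕ.+ 1))
      a-range = HasCard-interval (- + R) _ (identity (+ R) (+ K + + U + 1ℤ))
        where identity : ∀ R X → - R + (R + X) ≡ X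
              identity = solve-∀
      Restricted : P → Set
      Restricted p = (W p × (- + R ≤ a p × a p < + K + + U + 1ℤ)) × (- + U ≤ d p)
      forget : ∀ {p} → Restricted p → Region (+ R) (+ U) p
      forget ((w , -R≤a , _) , -U≤d) = -R≤a , w , -U≤d
      restore : ∀ p → Region (+ R) (+ U) p → Restricted p
      restore p (-R≤a , w , -U≤d) = (w , -R≤a , bounded-above -U≤d (proj₂ (a+d-bounded p w))) , -U≤d

    module _ {r u : ℤ} (R≤r : + R ≤ r) (U≤u : + U ≤ u) where

      Pieces : P → Set
      Pieces p = Region (+ R) (+ U) p ⊎ (Tail a r R p ⊎ Tail d u U p)

      join : ∀ {p} → Pieces p → Region r u p
      join {p} (inj₁ (-R≤a , w , -U≤d))         = ℤP.≤-trans (ℤP.neg-mono-≤ R≤r) -R≤a , w ,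
                                                  ℤP.≤-trans (ℤP.neg-mono-≤ U≤u) -U≤d
      join {p} (inj₂ (inj₁ (w , -r≤a , a<-R))) = -r≤a , w , ℤP.≤-trans (ℤP.neg-mono-≤ U≤u) (d-above p w a<-R)
      join {p} (inj₂ (inj₂ (w , -u≤d , d<-U))) = ℤP.≤-trans (ℤP.neg-mono-≤ R≤r) (a-above p w d<-U) , w , -u≤d

      split : ∀ p → Region r u p → Pieces p
      split p (-r≤a , w , -u≤d) with a p ℤ.<? - + R | d p ℤ.<? - + U
      ... | yes a<-R | _         = inj₂ (inj₁ (w , -r≤a , a<-R))
      ... | no  _    | yes d<-U  = inj₂ (inj₂ (w , -u≤d , d<-U))
      ... | no  a≮-R | no  d≮-U  = inj₁ (ℤP.≮⇒≥ a≮-R , w , ℤP.≮⇒≥ d≮-U)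

      core-disjoint : ∀ p → Region (+ R) (+ U) p → Tail a r R p ⊎ Tail d u U p → ⊥
      core-disjoint p (-R≤a , _ , _) (inj₁ (_ , _ , a<-R)) = ℤP.≤⇒≯ -R≤a a<-R
      core-disjoint p (_ , _ , -U≤d) (inj₂ (_ , _ , d<-U)) = ℤP.≤⇒≯ -U≤d d<-U

      tails-disjoint : ∀ p → Tail a r R p → Tail d u U p → ⊥
      tails-disjoint p (w , _ , a<-R) (_ , _ , d<-U) = ℤP.≤⇒≯ (d-above p w a<-R) d<-U

    count : ∀ r u → + R ≤ r → + U ≤ u → ∃ λ N* → ∃ λ N →
      HasCard (Region (+ R) (+ U)) N* × HasCard (Region r u) N × (+ N ≡ + N* + (r - + R) + (u - + U))
    count r u R≤r U≤u =
      let (N* , core) = HasCard-core in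
      N* , _ , core ,
      HasCard-cong (λ p → mk⇔ (join R≤r U≤u) (split R≤r U≤u p))
        (HasCard-⊎ (core-disjoint R≤r U≤u) core
          (HasCard-⊎ (tails-disjoint R≤r U≤u) (HasCard-tail A R R≤r) (HasCard-tail D U U≤u))) ,
      trans (cong₂ (λ x y → + N* + (x + y)) (+∣y-x∣≡y-x R≤r) (+∣y-x∣≡y-x U≤u))
            (sym (ℤP.+-assoc (+ N*) (r - + R) (u - + U)))

module Windows (m : ℕ) .{{_ : ℕ.NonZero m}} where

  InWindow : ℤ → ℤ → Set
  InWindow lo x = lo ≤ x × x < lo + + m

  -- writing x - lo = ρ + δ m with 0 ≤ ρ < m, the translate by -δ is lo + ρ
  shift : ℤ → ℤ → ℤ
  shift lo x = - ((x - lo) /ℕ m)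

  shift-into : ∀ lo x → InWindow lo (x + + m * shift lo x)
  shift-into lo x = subst (InWindow lo) (sym translate≡lo+ρ)
                      (ℤP.i≤i+j lo (+ ρ) , ℤP.+-monoʳ-< lo (+<+ (n%ℕd<d (x - lo) m)))
    where
    ρ : ℕ
    ρ = (x - lo) %ℕ m
    δ : ℤ
    δ = (x - lo) /ℕ m
    translate≡lo+ρ : x + + m * shift lo x ≡ lo + + ρ
    translate≡lo+ρ = begin
      x + + m * - δ                   ≡⟨ identity₁ x lo δ (+ m) ⟩
      lo + ((x - lo) - δ * + m)       ≡⟨ cong (λ z → lo + (z - δ * + m)) (a≡a%ℕn+[a/ℕn]*n (x - lo) m) ⟩
      lo + ((+ ρ + δ * + m) - δ * + m) ≡⟨ identity₂ lo (+ ρ) δ (+ m) ⟩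
      lo + + ρ                        ∎
      where
      open ≡-Reasoning
      identity₁ : ∀ x lo δ m → x + m * - δ ≡ lo + ((x - lo) - δ * m)
      identity₁ = solve-∀
      identity₂ : ∀ lo ρ δ m → lo + ((ρ + δ * m) - δ * m) ≡ lo + ρ
      identity₂ = solve-∀

  shift-≤ : ∀ lo x {k k'} → InWindow lo (x + + m * k) → InWindow lo (x + + m * k') → k' ≤ k
  shift-≤ lo x {k} {k'} (lo≤x+mk , _) (_ , x+mk'<lo+m) =
    subst (k' ≤_) (ℤP.pred-suc k) (ℤP.i<j⇒i≤pred[j] (ℤP.*-cancelˡ-<-nonNeg (+ m) mk'<m[1+k]))
    where
    mk'<m[1+k] : + m * k' < + m * (1ℤ + k)
    mk'<m[1+k] = <-by-gap (ℤP.+-mono-≤ (gap-< x+mk'<lo+m) (gap-≤ lo≤x+mk)) (identity lo x k k' (+ m))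
      where identity : ∀ lo x k k' m →
              ((lo + m) - (1ℤ + (x + m * k'))) + ((x + m * k) - lo) ≡ m * (1ℤ + k) - (1ℤ + m * k')
            identity = solve-∀

  shift-unique : ∀ lo x {k k'} → InWindow lo (x + + m * k) → InWindow lo (x + + m * k') → k ≡ k'
  shift-unique lo x w w' = ℤP.≤-antisym (shift-≤ lo x w' w) (shift-≤ lo x w w')

  InWindow-bounds : ∀ {lo x} → - + m ≤ lo → lo ≤ 0ℤ → InWindow lo x → - + m ≤ x × x ≤ + m
  InWindow-bounds {lo} -m≤lo lo≤0 (lo≤x , x<lo+m) =
    ℤP.≤-trans -m≤lo lo≤x , ℤP.<⇒≤ (ℤP.<-≤-trans x<lo+m (ℤP.+-monoˡ-≤ (+ m) lo≤0))

sum-cong : ∀ {n} {f g : Fin n → ℤ} → (∀ μ → f μ ≡ g μ) → sumℤ (tabulate f) ≡ sumℤ (tabulate g)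
sum-cong = cong sumℤ ∘ Vecₚ.tabulate-cong

sum-affine : ∀ {n} x y (v : Vec ℤ n) → sumℤ (tabulate (λ μ → x + y * lookup v μ)) ≡ + n * x + y * sumℤ v
sum-affine x y []      = identity x y
  where identity : ∀ x y → 0ℤ ≡ 0ℤ * x + y * 0ℤ
        identity = solve-∀
sum-affine {ℕ.suc n} x y (v₀ ∷ v) =
  trans (cong (λ S → x + y * v₀ + S) (sum-affine x y v)) (identity (+ n) x y v₀ (sumℤ v))
  where identity : ∀ n x y v₀ S → (x + y * v₀) + (n * x + y * S) ≡ (1ℤ + n) * x + y * (v₀ + S)
        identity = solve-∀

sum-offset : ∀ {n} x (v : Vec ℤ n) → sumℤ (tabulate (λ μ → x + lookup v μ)) ≡ + n * x + sumℤ v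
sum-offset {n} x v = begin
  sumℤ (tabulate (λ μ → x + lookup v μ))
    ≡⟨ sum-cong (λ μ → cong (λ z → x + z) (sym (ℤP.*-identityˡ (lookup v μ)))) ⟩
  sumℤ (tabulate (λ μ → x + 1ℤ * lookup v μ))  ≡⟨ sum-affine x 1ℤ v ⟩
  + n * x + 1ℤ * sumℤ v                        ≡⟨ cong (λ S → + n * x + S) (ℤP.*-identityˡ (sumℤ v)) ⟩
  + n * x + sumℤ v                             ∎
  where open ≡-Reasoning

sum-bounds : ∀ {n} lo hi (f : Fin n → ℤ) → (∀ μ → lo ≤ f μ × f μ ≤ hi) →
  + n * lo ≤ sumℤ (tabulate f) × sumℤ (tabulate f) ≤ + n * hi
sum-bounds {ℕ.zero}  lo hi f bounded = ℤP.≤-refl , ℤP.≤-refl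
sum-bounds {ℕ.suc n} lo hi f bounded =
  subst (_≤ _) (sym (ℤP.suc-* (+ n) lo)) (ℤP.+-mono-≤ (proj₁ (bounded zero)) (proj₁ rest)) ,
  subst (_ ≤_) (sym (ℤP.suc-* (+ n) hi)) (ℤP.+-mono-≤ (proj₂ (bounded zero)) (proj₂ rest))
  where
  rest : (+ n * lo ≤ sumℤ (tabulate (f ∘ suc))) × (sumℤ (tabulate (f ∘ suc)) ≤ + n * hi)
  rest = sum-bounds lo hi (f ∘ suc) (bounded ∘ suc)

module Omega (n : ℕ) where

  q : ℕ
  q = ℕ.suc n

  Q : ℤ
  Q = + q

  m : ℕ
  m = q ℕ.* q ℕ.+ q

  open Windows m

  a d : Point q → ℤ
  a (i , j , k) = i
  d (i , j , k) = - (Q * Q * i) - + m * sumℤ j - (Q + + 1) * sumℤ k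

  b c : Point q → Fin n → ℤ
  b (i , j , k) μ = i + + m * lookup k μ
  c (i , j , k) ν = Q * i + + m * lookup j ν - (Q + + 1) * sumℤ k

  c-translate : ∀ i j k ν → c (i , j , k) ν ≡ (Q * i - (Q + + 1) * sumℤ k) + + m * lookup j ν
  c-translate i j k ν = identity Q i (+ m) (lookup j ν) (sumℤ k)
    where identity : ∀ Q i M w K → Q * i + M * w - (Q + + 1) * K ≡ (Q * i - (Q + + 1) * K) + M * w
          identity = solve-∀

  Windowed : Vec ℤ n → Vec ℤ n → Point q → Set
  Windowed s t p = (∀ μ → InWindow (- lookup s μ) (b p μ)) × (∀ ν → InWindow (- lookup t ν) (c p ν))

  Ω⇔InΩ : ∀ {r u s t} p → (- r ≤ a p × Windowed s t p × - u ≤ d p) ⇔ InΩ q r s t u p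
  Ω⇔InΩ (i , j , k) = mk⇔ (λ (ra , (wb , wc) , ud) → ra , wb , wc , ud)
                          (λ (ra , wb , wc , ud) → ra , (wb , wc) , ud)

  -- Given i, the windows for the b's fix k, and then those for the c's fix j.
  module _ (s t : Vec ℤ n) where

    k-of : ℤ → Vec ℤ n
    k-of i = tabulate (λ μ → shift (- lookup s μ) i)

    c-base : ℤ → ℤ
    c-base i = Q * i - (Q + + 1) * sumℤ (k-of i)

    j-of : ℤ → Vec ℤ n
    j-of i = tabulate (λ ν → shift (- lookup t ν) (c-base i))

    point-of : ℤ → Point q
    point-of i = i , j-of i , k-of i

    point-of-Windowed : ∀ i → Windowed s t (point-of i)
    point-of-Windowed i =
      (λ μ → subst (λ z → InWindow (- lookup s μ) (i + + m * z)) (sym (Vecₚ.lookup∘tabulate _ μ))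
                   (shift-into (- lookup s μ) i)) ,
      (λ ν → subst (InWindow (- lookup t ν))
                   (sym (trans (c-translate i (j-of i) (k-of i) ν)
                               (cong (λ z → c-base i + + m * z) (Vecₚ.lookup∘tabulate _ ν))))
                   (shift-into (- lookup t ν) (c-base i)))

    point-of-a : ∀ p → Windowed s t p → point-of (a p) ≡ p
    point-of-a (i , j , k) (wb , wc) = cong₂ (λ j' k' → i , j' , k') j-of≡j k-of≡k
      where
      k-of≡k : k-of i ≡ k
      k-of≡k = trans (Vecₚ.tabulate-cong (λ μ → shift-unique (- lookup s μ) i
                                                  (shift-into (- lookup s μ) i) (wb μ)))
                     (Vecₚ.tabulate∘lookup k)
      wc′ : ∀ ν → InWindow (- lookup t ν) (c-base i + + m * lookup j ν)
      wc′ ν = subst (InWindow (- lookup t ν))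
                    (trans (c-translate i j k ν)
                           (cong (λ k' → (Q * i - (Q + + 1) * sumℤ k') + + m * lookup j ν) (sym k-of≡k)))
                    (wc ν)
      j-of≡j : j-of i ≡ j
      j-of≡j = trans (Vecₚ.tabulate-cong (λ ν → shift-unique (- lookup t ν) (c-base i)
                                                  (shift-into (- lookup t ν) (c-base i)) (wc′ ν)))
                     (Vecₚ.tabulate∘lookup j)

    coordinate-a : Coordinate (Windowed s t) a
    coordinate-a = record
      { point = point-of ; point-W = point-of-Windowed ; f-point = λ _ → refl ; point-f = point-of-a }

  -- A linear symmetry of Ω: it exchanges the b- and c-forms (so it carries the
  -- windows for (t, s) to those for (s, t)) and the two ends a and d.
  τ : Point q → Point q
  τ (i , j , k) = d (i , j , k)
                , tabulate (λ ν → (Q * i + (Q + + 1) * sumℤ j + sumℤ k) + lookup k ν)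
                , tabulate (λ μ → (i + sumℤ j) + lookup j μ)

  τ-b : ∀ p μ → b (τ p) μ ≡ c p μ
  τ-b (i , j , k) μ = trans (cong (λ z → d (i , j , k) + + m * z) (Vecₚ.lookup∘tabulate _ μ))
                            (identity (+ n) i (sumℤ j) (sumℤ k) (lookup j μ))
    where identity : ∀ N i J K jμ → let Q = 1ℤ + N ; M = Q * Q + Q in
            (- (Q * Q * i) - M * J - (Q + + 1) * K) + M * ((i + J) + jμ) ≡ Q * i + M * jμ - (Q + + 1) * K
          identity = solve-∀

  τ-c : ∀ p ν → c (τ p) ν ≡ b p ν
  τ-c (i , j , k) ν = trans (cong₂ (λ z K′ → Q * d (i , j , k) + + m * z - (Q + + 1) * K′)
                                   (Vecₚ.lookup∘tabulate _ ν) (sum-offset (i + sumℤ j) j))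
                            (identity (+ n) i (sumℤ j) (sumℤ k) (lookup k ν))
    where identity : ∀ N i J K kν → let Q = 1ℤ + N ; M = Q * Q + Q in
            Q * (- (Q * Q * i) - M * J - (Q + + 1) * K) + M * ((Q * i + (Q + + 1) * J + K) + kν)
              - (Q + + 1) * (N * (i + J) + J) ≡ i + M * kν
          identity = solve-∀

  τ-d : ∀ p → d (τ p) ≡ a p
  τ-d (i , j , k) = trans (cong₂ (λ J′ K′ → - (Q * Q * d (i , j , k)) - + m * J′ - (Q + + 1) * K′)
                                 (sum-offset (Q * i + (Q + + 1) * sumℤ j + sumℤ k) k)
                                 (sum-offset (i + sumℤ j) j))
                          (identity (+ n) i (sumℤ j) (sumℤ k))
    where identity : ∀ N i J K → let Q = 1ℤ + N ; M = Q * Q + Q in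
            - (Q * Q * (- (Q * Q * i) - M * J - (Q + + 1) * K)) - M * (N * (Q * i + (Q + + 1) * J + K) + K)
              - (Q + + 1) * (N * (i + J) + J) ≡ i
          identity = solve-∀

  τ-Windowed : ∀ s t p → Windowed t s p → Windowed s t (τ p)
  τ-Windowed s t p (wb , wc) = (λ μ → subst (InWindow (- lookup s μ)) (sym (τ-b p μ)) (wc μ))
                             , (λ ν → subst (InWindow (- lookup t ν)) (sym (τ-c p ν)) (wb ν))

  coordinate-d : ∀ s t → Coordinate (Windowed s t) d
  coordinate-d s t = swap-coordinate τ (coordinate-a t s) (coordinate-a s t)
                       (τ-Windowed s t) (τ-Windowed t s) τ-d (λ _ → refl)

  Bounded : Vec ℤ n → Set
  Bounded s = ∀ μ → (+ 0 ≤ lookup s μ) × (lookup s μ < + (q ℕ.^ 2 ℕ.+ q))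

  Bounded-window : ∀ {s x} → (+ 0 ≤ s) × (s < + (q ℕ.^ 2 ℕ.+ q)) →
    InWindow (- s) x → - + m ≤ x × x ≤ + m
  Bounded-window {s} (0≤s , s<q²+q) = InWindow-bounds (ℤP.neg-mono-≤ (ℤP.<⇒≤ s<m)) (ℤP.neg-mono-≤ 0≤s)
    where s<m : s < + m
          s<m = subst (λ z → s < + (q ℕ.* z ℕ.+ q)) (ℕP.*-identityʳ q) s<q²+q

  a+d≡-Σ : ∀ p → a p + d p ≡ - (sumℤ (tabulate (b p)) + sumℤ (tabulate (c p)))
  a+d≡-Σ (i , j , k) =
    trans (identity (+ n) i (sumℤ j) (sumℤ k)) (cong₂ (λ B C → - (B + C)) (sym Σb) (sym Σc))
    where
    Σb : sumℤ (tabulate (b (i , j , k))) ≡ + n * i + + m * sumℤ k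
    Σb = sum-affine i (+ m) k
    Σc : sumℤ (tabulate (c (i , j , k))) ≡ + n * (Q * i - (Q + + 1) * sumℤ k) + + m * sumℤ j
    Σc = trans (sum-cong (c-translate i j k)) (sum-affine (Q * i - (Q + + 1) * sumℤ k) (+ m) j)
    identity : ∀ N i J K → let Q = 1ℤ + N ; M = Q * Q + Q in
      i + (- (Q * Q * i) - M * J - (Q + + 1) * K)
        ≡ - ((N * i + M * K) + (N * (Q * i - (Q + + 1) * K) + M * J))
    identity = solve-∀

  R U : ℕ
  R = q ℕ.^ 3 ∸ q
  U = q ℕ.^ 3 ℕ.+ q ℕ.^ 2

  R≡nm : R ≡ n ℕ.* m
  R≡nm = trans (cong (_∸ q) (cube n)) (ℕP.m+n∸n≡m (n ℕ.* m) q)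
    where
    -- q³ = (q - 1)(q² + q) + q, with q³ unfolded as q * (q * (q * 1))
    cube : ∀ n → (1 ℕ.+ n) ℕ.* ((1 ℕ.+ n) ℕ.* ((1 ℕ.+ n) ℕ.* 1))
                 ≡ n ℕ.* ((1 ℕ.+ n) ℕ.* (1 ℕ.+ n) ℕ.+ (1 ℕ.+ n)) ℕ.+ (1 ℕ.+ n)
    cube = ℕ-Solver.solve-∀

  R+R≤R+U+1 : R ℕ.+ R ℕ.≤ R ℕ.+ U ℕ.+ 1
  R+R≤R+U+1 = ℕP.≤-trans (ℕP.+-monoʳ-≤ R R≤U) (ℕP.m≤m+n (R ℕ.+ U) 1)
    where R≤U : R ℕ.≤ U
          R≤U = ℕP.≤-trans (ℕP.m∸n≤m (q ℕ.^ 3) q) (ℕP.m≤m+n (q ℕ.^ 3) (q ℕ.^ 2))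

  -- each of the 2(q - 1) windowed forms lies in [-m, m], so |a + d| ≤ 2(q - 1)m = 2r*
  a+d-bounded : ∀ {s t} → Bounded s → Bounded t →
    ∀ p → Windowed s t p → (- + (R ℕ.+ R) ≤ a p + d p) × (a p + d p ≤ + (R ℕ.+ R))
  a+d-bounded s-bounded t-bounded p (wb , wc) = lower , upper
    where
    open ℤP.≤-Reasoning
    Σb : (+ n * - + m ≤ sumℤ (tabulate (b p))) × (sumℤ (tabulate (b p)) ≤ + n * + m)
    Σb = sum-bounds (- + m) (+ m) (b p) (λ μ → Bounded-window (s-bounded μ) (wb μ))
    Σc : (+ n * - + m ≤ sumℤ (tabulate (c p))) × (sumℤ (tabulate (c p)) ≤ + n * + m)
    Σc = sum-bounds (- + m) (+ m) (c p) (λ ν → Bounded-window (t-bounded ν) (wc ν))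
    +R≡nm : + R ≡ + n * + m
    +R≡nm = trans (cong +_ R≡nm) (ℤP.pos-* n m)
    lower : - + (R ℕ.+ R) ≤ a p + d p
    lower = begin
      - (+ R + + R)                                          ≡⟨ cong (λ x → - (x + x)) +R≡nm ⟩
      - (+ n * + m + + n * + m)                              ≤⟨ ℤP.neg-mono-≤ (ℤP.+-mono-≤ (proj₂ Σb) (proj₂ Σc)) ⟩
      - (sumℤ (tabulate (b p)) + sumℤ (tabulate (c p)))      ≡⟨ a+d≡-Σ p ⟨
      a p + d p                                              ∎
    upper : a p + d p ≤ + (R ℕ.+ R)
    upper = begin
      a p + d p                                              ≡⟨ a+d≡-Σ p ⟩
      - (sumℤ (tabulate (b p)) + sumℤ (tabulate (c p)))      ≤⟨ ℤP.neg-mono-≤ (ℤP.+-mono-≤ (proj₁ Σb) (proj₁ Σc)) ⟩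
      - (+ n * - + m + + n * - + m)                          ≡⟨ identity (+ n) (+ m) ⟩
      + n * + m + + n * + m                                  ≡⟨ cong (λ x → x + x) +R≡nm ⟨
      + R + + R                                              ∎
      where identity : ∀ N M → - (N * - M + N * - M) ≡ N * M + N * M
            identity = solve-∀

prime-power-nonZero : ∀ {q} → IsPrimePower q → ℕ.NonZero q
prime-power-nonZero (p , k , p-prime , _ , refl) = ℕP.m^n≢0 p k {{prime⇒nonZero p-prime}}

lemma3p6 : (q : ℕ) → IsPrimePower q →
    (r u : ℤ) → (s t : Vec ℤ (q ∸ 1)) →
    (+ (q ℕ.^ 3 ∸ q) ≤ r) → (+ (q ℕ.^ 3 ℕ.+ q ℕ.^ 2) ≤ u) →
    (∀ (μ : Fin (q ∸ 1)) → (+ 0 ≤ lookup s μ) × (lookup s μ < + (q ℕ.^ 2 ℕ.+ q))) →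
    (∀ (ν : Fin (q ∸ 1)) → (+ 0 ≤ lookup t ν) × (lookup t ν < + (q ℕ.^ 2 ℕ.+ q))) →
    ∃ λ (N* : ℕ) → ∃ λ (N : ℕ) →
      HasCard (InΩ q (+ (q ℕ.^ 3 ∸ q)) s t (+ (q ℕ.^ 3 ℕ.+ q ℕ.^ 2))) N*
      × HasCard (InΩ q r s t u) N
      × (+ N ≡ + N* + (r - + (q ℕ.^ 3 ∸ q)) + (u - + (q ℕ.^ 3 ℕ.+ q ℕ.^ 2)))
lemma3p6 ℕ.zero q-prime-power = ⊥-elim (ℕ.NonZero.nonZero (prime-power-nonZero q-prime-power))
lemma3p6 (ℕ.suc n) _ r u s t R≤r U≤u s-bounded t-bounded =
  let (N* , N , core , region , N≡N*+…) = count R U R+R≤R+U+1 r u R≤r U≤u in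
  N* , N , HasCard-cong (Ω⇔InΩ {+ R} {+ U} {s} {t}) core ,
  HasCard-cong (Ω⇔InΩ {r} {u} {s} {t}) region , N≡N*+…
  where
  open Omega n
  open TwoCoordinates (coordinate-a s t) (coordinate-d s t) (R ℕ.+ R)
                      (a+d-bounded {s} {t} s-bounded t-bounded)
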